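{- Let $\mathrm{M}$ be a loopless matroid of rank $r+1$ on $E=\{0,1,\dots,n\}$. For every positive integer $k\le r$, $\mu^k(\mathrm{M})=|\mathrm{D}_k(\mathrm{M})|$.
   Context: The characteristic polynomial is $\chi_\mathrm{M}(\lambda)=\sum_{I\subseteq E}(-1)^{|I|}\lambda^{\mathrm{crk}(I)}$ with $\mathrm{crk}(I)=\mathrm{rk}(E)-\mathrm{rk}(I)$; the reduced characteristic polynomial is $\overline\chi_\mathrm{M}(\lambda)=\chi_\mathrm{M}(\lambda)/(\lambda-1)$, and the integers $\mu^k(\mathrm{M})$ are defined by $\overline\chi_\mathrm{M}(\lambda)=\sum_{k=0}^r(-1)^k\mu^k(\mathrm{M})\lambda^{r-k}$. A $k$-step flag $F_1\subsetneq\cdots\subsetneq F_k$ of nonempty proper flats is initial if $\mathrm{rk}(F_m)=m$ for all $m$, and descending if $\min(F_1)>\min(F_2)>\cdots>\min(F_k)>0$ (minimum elements in $\{0,\dots,n\}$). $\mathrm{D}_k(\mathrm{M})$ is the set of initial descending $k$-step flags of nonempty proper flats. -}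

module Defs where

import Data.Bool
open import Data.Bool using (Bool; true; false; _∧_; _∨_; not; if_then_else_)
open import Data.Nat using (ℕ; zero; suc; _+_; _∸_; _≤_; _<_; _≡ᵇ_; _<ᵇ_)
open import Data.Integer using (ℤ; +_; -_) renaming (_+_ to _+ℤ_; _*_ to _*ℤ_)
open import Data.Fin using (Fin; toℕ)
open import Data.Fin.Subset using (Subset; _⊆_; _∪_; _∩_; ∣_∣; ⁅_⁆; ⊤; ⊥; inside; outside; _∈_)
open import Data.Vec using (Vec; []; _∷_; lookup; allFin)
import Data.Vec as Vec
open import Data.List using (List; []; _∷_; map; concatMap; length; filter; foldr; upTo)
import Data.List as List
open import Relation.Nullary.Decidable using (does)
open import Data.Fin.Subset.Properties using (_⊆?_)
open import Relation.Binary.PropositionalEquality using (_≡_)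

record Matroid (m : ℕ) : Set where
  field
    rk        : Subset m → ℕ
    rk-bound  : ∀ X → rk X ≤ ∣ X ∣
    rk-mono   : ∀ X Y → X ⊆ Y → rk X ≤ rk Y
    rk-submod : ∀ X Y → rk (X ∪ Y) + rk (X ∩ Y) ≤ rk X + rk Y

open Matroid public

Loopless : ∀ {m} → Matroid m → Set
Loopless M = ∀ e → rk M ⁅ e ⁆ ≡ 1

allSubsets : (m : ℕ) → List (Subset m)
allSubsets zero    = [] ∷ []
allSubsets (suc m) = concatMap (λ X → (outside ∷ X) ∷ (inside ∷ X) ∷ []) (allSubsets m)

allVecs : ∀ {A : Set} → List A → (k : ℕ) → List (Vec A k)
allVecs xs zero    = [] ∷ []
allVecs xs (suc k) = concatMap (λ x → map (x ∷_) (allVecs xs k)) xs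

allB : ∀ {m} → (Fin m → Bool) → Bool
allB {m} p = Vec.foldr _ (λ i b → p i ∧ b) true (allFin m)

isFlat : ∀ {m} → Matroid m → Subset m → Bool
isFlat M F = allB (λ e → lookup F e ∨ (rk M F <ᵇ rk M (F ∪ ⁅ e ⁆)))

_≟S_ : ∀ {m} → Subset m → Subset m → Bool
X ≟S Y = does (X ⊆? Y) ∧ does (Y ⊆? X)

isNonempty : ∀ {m} → Subset m → Bool
isNonempty X = not (X ≟S ⊥)

isProper : ∀ {m} → Subset m → Bool
isProper X = not (X ≟S ⊤)

-- minimum element of a subset, as a natural number (index of the first
-- 'inside'); only used on nonempty subsets (returns m on the empty one)
minElem : ∀ {m} → Subset m → ℕ
minElem []             = 0
minElem (true  ∷ X)    = 0
minElem (false ∷ X)    = suc (minElem X)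

-- Initial descending k-step flags F₁ ⊊ ⋯ ⊊ F_k of nonempty proper flats
-- (vector positions 0..k-1 hold F₁..F_k)

isInitialDescFlag : ∀ {m k} → Matroid m → Vec (Subset m) k → Bool
isInitialDescFlag {m} {k} M Fs =
  allB (λ i → let F = lookup Fs i in
                isFlat M F ∧ isNonempty F ∧ isProper F
                ∧ (rk M F ≡ᵇ suc (toℕ i))                 -- initial: rk(F_{i+1}) = i+1
                ∧ (0 <ᵇ minElem F))                        -- min(F_k) > 0
  ∧ allB (λ i → allB (λ j →
        not (suc (toℕ i) ≡ᵇ toℕ j)
        ∨ (let F = lookup Fs i ; G = lookup Fs j in
             does (F ⊆? G) ∧ not (does (G ⊆? F))
             ∧ (minElem G <ᵇ minElem F))))

cardD : ∀ {m} → Matroid m → (k : ℕ) → ℕ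
cardD {m} M k = length (filter (λ Fs → isInitialDescFlag M Fs Data.Bool.≟ true)
                               (allVecs (allSubsets m) k))

-- Characteristic polynomial  χ_M(λ) = Σ_{I ⊆ E} (-1)^{|I|} λ^{crk I},
-- represented by its coefficients:  chiCoeff M j = coefficient of λ^j.

sign : ℕ → ℤ
sign zero    = + 1
sign (suc n) = - sign n

sumℤ : List ℤ → ℤ
sumℤ = foldr _+ℤ_ (+ 0)

crk : ∀ {m} → Matroid m → Subset m → ℕ
crk M I = rk M ⊤ ∸ rk M I

chiCoeff : ∀ {m} → Matroid m → ℕ → ℤ
chiCoeff {m} M j =
  sumℤ (map (λ I → if crk M I ≡ᵇ j then sign ∣ I ∣ else + 0) (allSubsets m))

-- Reduced characteristic polynomial χ̄_M(λ) = χ_M(λ)/(λ-1), computed by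
-- synthetic division: if χ = Σ_{i ≤ d} a_i λ^i with d = rk(E), then the
-- quotient by (λ - 1) has coefficient of λ^j equal to Σ_{j < i ≤ d} a_i.
chiBarCoeff : ∀ {m} → Matroid m → ℕ → ℤ
chiBarCoeff M j =
  sumℤ (map (λ i → if j <ᵇ i then chiCoeff M i else + 0) (upTo (suc (rk M ⊤))))

-- μ^k(M), defined by χ̄_M(λ) = Σ_{k=0}^{r} (-1)^k μ^k(M) λ^{r-k}, r = rk(E) - 1
mu : ∀ {m} → Matroid m → ℕ → ℤ
mu M k = sign k *ℤ chiBarCoeff M ((rk M ⊤ ∸ 1) ∸ k)

module Submission where

-- For a set G and j ≥ 0 let A(G, j) = Σ_{I ⊆ G, rk I ≤ j} (-1)^|I|.
-- (1) Reading coefficients off χ_M(λ) = Σ_I (-1)^|I| λ^{crk I} and dividing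
--     by λ - 1 gives μ^k(M) = (-1)^k A(E, k)                     (mu-as-A).
-- (2) Deletion recurrence: for a flat G and s ∈ G,
--       A(G, j+1) = - Σ { A(H, j) : H ⊆ G a flat of rank j+1, s ∉ H }.
--     Pairing I with I ∪ {s} leaves only the sets whose rank jumps past j+1
--     when s is added; each lies in exactly one such H (its closure), and
--     inside H these sets sum to -A(H, j) because the full alternating sum
--     over the subsets of a nonempty set vanishes              (Deletion).
-- (3) With s = min G, a rank-(j+1) flat H ⊆ G misses s iff min H > min G, so
--     the H in (2) are the possible next members of a descending flag below
--     G, and (-1)^j A(G, j) counts such flags    (flagsBelow-alternating).
-- (4) Enumerating flags as vectors with the top member last reproduces
--     this count, and for G = E the condition "below E" is automatic
--     (flagsBelow-enumerated, cardD-as-count).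

open import Defs
open import Data.Nat using (ℕ; suc; _≤_)
open import Data.Integer using (+_)
open import Data.Fin.Subset using (⊤)
open import Relation.Binary.PropositionalEquality using (_≡_)

open import Data.Bool using (Bool; true; false; _∧_; _∨_; not; if_then_else_; T)
open import Data.Bool.Properties using (T-∧; T-∨; T-≡; ∧-comm; ∧-identityʳ; ∧-assoc)
open import Data.Bool.Solver using (module ∨-∧-Solver)
open ∨-∧-Solver using (solve; _:*_; _:=_)
open import Data.Nat using (zero; _+_; _∸_; _<_; z≤n; s≤s; s≤s⁻¹; _≡ᵇ_; _<ᵇ_; _≟_; _≤?_; _<?_)
open import Data.Nat.Properties
open import Data.Integer using (ℤ; -_; 0ℤ; 1ℤ) renaming (_+_ to _+ℤ_; _*_ to _*ℤ_)
import Data.Integer.Properties as ℤ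
open import Data.Integer.Tactic.RingSolver using (solve-∀)
open import Algebra.Bundles using (AbelianGroup)
open import Algebra.Properties.Group (AbelianGroup.group ℤ.+-0-abelianGroup) using (inverseˡ-unique)
open import Data.Fin using (Fin; zero; suc; toℕ; inject₁; fromℕ)
open import Data.Fin.Properties using (¬∀⟶∃¬; toℕ-injective; toℕ-inject₁; toℕ-fromℕ; toℕ<n)
open import Data.Fin.Subset using (Subset; _⊆_; _∪_; _∩_; ∣_∣; ⁅_⁆; ⊥; inside; outside; _∈_; _∉_)
open import Data.Fin.Subset.Properties
open import Data.Vec using (Vec; []; _∷_; lookup; _∷ʳ_; tabulate; here; there)
open import Data.Vec.Properties using (∷-injectiveʳ; []=⇒lookup; lookup⇒[]=)
import Data.Vec as Vec
open import Data.List using (List; []; _∷_; map; concatMap; _++_; filter; length; upTo; applyUpTo)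
open import Data.List.Properties using (map-applyUpTo)
open import Data.Product using (Σ; ∃; _×_; _,_; proj₁; proj₂)
open import Data.Sum using (_⊎_; inj₁; inj₂) renaming (map to ⊎-map)
open import Data.Empty using (⊥-elim)
open import Function using (_∘_; _⇔_; mk⇔; Equivalence)
open import Relation.Nullary using (Dec; yes; no; ¬_; does; contradiction)
open import Relation.Nullary.Decidable using (T?; _×-dec_; _⊎-dec_; ¬?; dec-true; dec-false) renaming (map to Dec-map)
open import Relation.Binary.PropositionalEquality using (refl; sym; trans; cong; cong₂; subst; module ≡-Reasoning)

ΣL : {A : Set} → List A → (A → ℤ) → ℤ
ΣL xs f = sumℤ (map f xs)

[_]·_ : {P : Set} → Dec P → ℤ → ℤ
[ d ]· x = if does d then x else 0ℤ

module _ {A : Set} where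

  Σ-cong : (xs : List A) {f g : A → ℤ} → (∀ x → f x ≡ g x) → ΣL xs f ≡ ΣL xs g
  Σ-cong []       f≗g = refl
  Σ-cong (x ∷ xs) f≗g = cong₂ _+ℤ_ (f≗g x) (Σ-cong xs f≗g)

  Σ-vanish : (xs : List A) {f : A → ℤ} → (∀ x → f x ≡ 0ℤ) → ΣL xs f ≡ 0ℤ
  Σ-vanish []       f≗0 = refl
  Σ-vanish (x ∷ xs) f≗0 = cong₂ _+ℤ_ (f≗0 x) (Σ-vanish xs f≗0)

  Σ-++ : (xs ys : List A) (f : A → ℤ) → ΣL (xs ++ ys) f ≡ ΣL xs f +ℤ ΣL ys f
  Σ-++ []       ys f = sym (ℤ.+-identityˡ _)
  Σ-++ (x ∷ xs) ys f = trans (cong (f x +ℤ_) (Σ-++ xs ys f)) (sym (ℤ.+-assoc (f x) _ _))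

  Σ-+ : (xs : List A) (f g : A → ℤ) → ΣL xs (λ x → f x +ℤ g x) ≡ ΣL xs f +ℤ ΣL xs g
  Σ-+ []       f g = refl
  Σ-+ (x ∷ xs) f g = trans (cong (f x +ℤ g x +ℤ_) (Σ-+ xs f g)) (interchange (f x) (g x) _ _)
    where
    interchange : ∀ a b c d → (a +ℤ b) +ℤ (c +ℤ d) ≡ (a +ℤ c) +ℤ (b +ℤ d)
    interchange = solve-∀

  Σ-neg : (xs : List A) (f : A → ℤ) → ΣL xs (λ x → - f x) ≡ - ΣL xs f
  Σ-neg []       f = refl
  Σ-neg (x ∷ xs) f = trans (cong (- f x +ℤ_) (Σ-neg xs f)) (sym (ℤ.neg-distrib-+ (f x) _))

  Σ-*ˡ : (xs : List A) (c : ℤ) (f : A → ℤ) → ΣL xs (λ x → c *ℤ f x) ≡ c *ℤ ΣL xs f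
  Σ-*ˡ []       c f = sym (ℤ.*-zeroʳ c)
  Σ-*ˡ (x ∷ xs) c f = trans (cong (c *ℤ f x +ℤ_) (Σ-*ˡ xs c f)) (sym (ℤ.*-distribˡ-+ c (f x) _))

  Σ-guard : {P : Set} (d : Dec P) (xs : List A) (f : A → ℤ) → ΣL xs (λ x → [ d ]· f x) ≡ [ d ]· ΣL xs f
  Σ-guard (yes _) xs f = refl
  Σ-guard (no _)  xs f = Σ-vanish xs (λ _ → refl)

guard-comm : {P Q : Set} (p? : Dec P) (q? : Dec Q) (x : ℤ) → [ p? ]· ([ q? ]· x) ≡ [ q? ]· ([ p? ]· x)
guard-comm (yes _) (yes _) x = refl
guard-comm (yes _) (no _)  x = refl
guard-comm (no _)  (yes _) x = refl
guard-comm (no _)  (no _)  x = refl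

guard-⇔ : {P Q : Set} → P ⇔ Q → (p? : Dec P) (q? : Dec Q) (x : ℤ) → [ p? ]· x ≡ [ q? ]· x
guard-⇔ P⇔Q (yes _) (yes _) x = refl
guard-⇔ P⇔Q (no _)  (no _)  x = refl
guard-⇔ P⇔Q (yes p) (no ¬q) x = contradiction (Equivalence.to P⇔Q p) ¬q
guard-⇔ P⇔Q (no ¬p) (yes q) x = contradiction (Equivalence.from P⇔Q q) ¬p

guard-∧ : (a b : Bool) (x : ℤ) → [ T? (a ∧ b) ]· x ≡ [ T? a ]· ([ T? b ]· x)
guard-∧ true  b x = refl
guard-∧ false b x = refl

Σ-map : {A B : Set} (g : A → B) (xs : List A) (f : B → ℤ) → ΣL (map g xs) f ≡ ΣL xs (f ∘ g)
Σ-map g []       f = refl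
Σ-map g (x ∷ xs) f = cong (f (g x) +ℤ_) (Σ-map g xs f)

Σ-concatMap : {A B : Set} (g : A → List B) (xs : List A) (f : B → ℤ) →
  ΣL (concatMap g xs) f ≡ ΣL xs (λ x → ΣL (g x) f)
Σ-concatMap g []       f = refl
Σ-concatMap g (x ∷ xs) f = trans (Σ-++ (g x) (concatMap g xs) f) (cong (ΣL (g x) f +ℤ_) (Σ-concatMap g xs f))

Σ-swap : {A B : Set} (xs : List A) (ys : List B) (f : A → B → ℤ) →
  ΣL xs (λ x → ΣL ys (f x)) ≡ ΣL ys (λ y → ΣL xs (λ x → f x y))
Σ-swap []       ys f = sym (Σ-vanish ys (λ _ → refl))
Σ-swap (x ∷ xs) ys f =
  trans (cong (ΣL ys (f x) +ℤ_) (Σ-swap xs ys f)) (sym (Σ-+ ys (f x) (λ y → ΣL xs (λ x → f x y))))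

Σ-upTo-delta : (h : ℕ → ℤ) (N c : ℕ) → c < N → ΣL (upTo N) (λ i → [ c ≟ i ]· h i) ≡ h c
Σ-upTo-delta h (suc N) c c<N = trans (cong ([ c ≟ 0 ]· h 0 +ℤ_) tail) (head c c<N)
  where
  tail : ΣL (applyUpTo suc N) (λ i → [ c ≟ i ]· h i) ≡ ΣL (upTo N) (λ i → [ c ≟ suc i ]· h (suc i))
  tail = trans (cong (λ l → ΣL l _) (sym (map-applyUpTo (λ i → i) suc N))) (Σ-map suc (upTo N) _)
  head : ∀ c → c < suc N → [ c ≟ 0 ]· h 0 +ℤ ΣL (upTo N) (λ i → [ c ≟ suc i ]· h (suc i)) ≡ h c
  head zero    _         = trans (cong (h 0 +ℤ_) (Σ-vanish (upTo N) (λ _ → refl))) (ℤ.+-identityʳ (h 0))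
  head (suc c) (s≤s c<N) = trans (ℤ.+-identityˡ _) (Σ-upTo-delta (h ∘ suc) N c c<N)

ΣS : (m : ℕ) → (Subset m → ℤ) → ℤ
ΣS m f = ΣL (allSubsets m) f

ΣS-split : ∀ m (f : Subset (suc m) → ℤ) → ΣS (suc m) f ≡ ΣS m (λ X → f (outside ∷ X) +ℤ f (inside ∷ X))
ΣS-split m f = trans (Σ-concatMap _ (allSubsets m) f)
                     (Σ-cong (allSubsets m) (λ X → cong (f (outside ∷ X) +ℤ_) (ℤ.+-identityʳ _)))

ΣS-toggle : ∀ m (e : Fin m) (f : Subset m → ℤ) →
  ΣS m f ≡ ΣS m (λ X → [ ¬? (e ∈? X) ]· (f X +ℤ f (X ∪ ⁅ e ⁆)))
ΣS-toggle (suc m) zero f =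
  trans (ΣS-split m f) (trans (Σ-cong (allSubsets m) pair) (sym (ΣS-split m _)))
  where
  pair : ∀ X → f (outside ∷ X) +ℤ f (inside ∷ X) ≡ (f (outside ∷ X) +ℤ f (inside ∷ (X ∪ ⊥))) +ℤ 0ℤ
  pair X rewrite ∪-identityʳ X = sym (ℤ.+-identityʳ _)
ΣS-toggle (suc m) (suc e) f =
  trans (ΣS-split m f) (trans (ΣS-toggle m e h) (trans (Σ-cong (allSubsets m) regroup) (sym (ΣS-split m _))))
  where
  h : Subset m → ℤ
  h X = f (outside ∷ X) +ℤ f (inside ∷ X)
  interchange : ∀ a b c d → (a +ℤ b) +ℤ (c +ℤ d) ≡ (a +ℤ c) +ℤ (b +ℤ d)
  interchange = solve-∀
  regroup : ∀ X → [ ¬? (e ∈? X) ]· (h X +ℤ h (X ∪ ⁅ e ⁆))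
                ≡ [ ¬? (e ∈? X) ]· (f (outside ∷ X) +ℤ f (outside ∷ (X ∪ ⁅ e ⁆)))
                  +ℤ [ ¬? (e ∈? X) ]· (f (inside ∷ X) +ℤ f (inside ∷ (X ∪ ⁅ e ⁆)))
  regroup X with e ∈? X
  ... | yes _ = refl
  ... | no _  = interchange (f (outside ∷ X)) (f (inside ∷ X)) _ _

ΣS-delta : ∀ m (Y : Subset m) (f : Subset m → ℤ) → (∀ X → ¬ X ≡ Y → f X ≡ 0ℤ) → ΣS m f ≡ f Y
ΣS-delta zero    []            f off = ℤ.+-identityʳ (f [])
ΣS-delta (suc m) (outside ∷ Y) f off = begin
  ΣS (suc m) f                                                        ≡⟨ ΣS-split m f ⟩
  ΣS m (λ X → f (outside ∷ X) +ℤ f (inside ∷ X))                      ≡⟨ Σ-+ (allSubsets m) _ _ ⟩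
  ΣS m (λ X → f (outside ∷ X)) +ℤ ΣS m (λ X → f (inside ∷ X))
    ≡⟨ cong₂ _+ℤ_ (ΣS-delta m Y _ (λ X X≢Y → off _ (X≢Y ∘ ∷-injectiveʳ)))
                  (Σ-vanish (allSubsets m) (λ X → off _ λ ())) ⟩
  f (outside ∷ Y) +ℤ 0ℤ                                               ≡⟨ ℤ.+-identityʳ _ ⟩
  f (outside ∷ Y)                                                     ∎
  where open ≡-Reasoning
ΣS-delta (suc m) (inside ∷ Y) f off = begin
  ΣS (suc m) f                                                        ≡⟨ ΣS-split m f ⟩
  ΣS m (λ X → f (outside ∷ X) +ℤ f (inside ∷ X))                      ≡⟨ Σ-+ (allSubsets m) _ _ ⟩
  ΣS m (λ X → f (outside ∷ X)) +ℤ ΣS m (λ X → f (inside ∷ X))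
    ≡⟨ cong₂ _+ℤ_ (Σ-vanish (allSubsets m) (λ X → off _ λ ()))
                  (ΣS-delta m Y _ (λ X X≢Y → off _ (X≢Y ∘ ∷-injectiveʳ))) ⟩
  0ℤ +ℤ f (inside ∷ Y)                                                ≡⟨ ℤ.+-identityˡ _ ⟩
  f (inside ∷ Y)                                                      ∎
  where open ≡-Reasoning

ΣS-unique : ∀ m {P : Subset m → Set} (P? : ∀ X → Dec (P X)) (Y : Subset m) (f : Subset m → ℤ) →
  P Y → (∀ X → P X → X ≡ Y) → ΣS m (λ X → [ P? X ]· f X) ≡ f Y
ΣS-unique m {P} P? Y f PY unique = trans (ΣS-delta m Y _ off) (at-Y (P? Y))
  where
  off : ∀ X → ¬ X ≡ Y → [ P? X ]· f X ≡ 0ℤ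
  off X X≢Y with P? X
  ... | yes PX = contradiction (unique X PX) X≢Y
  ... | no  _  = refl
  at-Y : (d : Dec (P Y)) → [ d ]· f Y ≡ f Y
  at-Y (yes _) = refl
  at-Y (no ¬PY) = contradiction PY ¬PY

∣∪⁅⁆∣ : ∀ {m} (X : Subset m) {e} → e ∉ X → ∣ X ∪ ⁅ e ⁆ ∣ ≡ suc ∣ X ∣
∣∪⁅⁆∣ (outside ∷ X) {zero}  e∉X rewrite ∪-identityʳ X = refl
∣∪⁅⁆∣ (inside  ∷ X) {zero}  e∉X = contradiction here e∉X
∣∪⁅⁆∣ (outside ∷ X) {suc e} e∉X = ∣∪⁅⁆∣ X (e∉X ∘ there)
∣∪⁅⁆∣ (inside  ∷ X) {suc e} e∉X = cong suc (∣∪⁅⁆∣ X (e∉X ∘ there))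

∪⁅⁆⊆ : ∀ {m} {X H : Subset m} {e} → X ⊆ H → e ∈ H → X ∪ ⁅ e ⁆ ⊆ H
∪⁅⁆⊆ {X = X} {e = e} X⊆H e∈H x∈X∪e with x∈p∪q⁻ X ⁅ e ⁆ x∈X∪e
... | inj₁ x∈X = X⊆H x∈X
... | inj₂ x∈e rewrite x∈⁅y⁆⇒x≡y e x∈e = e∈H

∪⁅⁆⊆⁻ : ∀ {m} {X H : Subset m} {e} → X ∪ ⁅ e ⁆ ⊆ H → X ⊆ H
∪⁅⁆⊆⁻ {e = e} X∪e⊆H x∈X = X∪e⊆H (p⊆p∪q ⁅ e ⁆ x∈X)

σ : ∀ {m} → Subset m → ℤ
σ I = sign ∣ I ∣

σ-flip : ∀ {m} (I : Subset m) {e} → e ∉ I → σ (I ∪ ⁅ e ⁆) ≡ - σ I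
σ-flip I e∉I rewrite ∣∪⁅⁆∣ I e∉I = refl

alternating-zero : ∀ {m} (H : Subset m) {e} → e ∈ H → ΣS m (λ I → [ I ⊆? H ]· σ I) ≡ 0ℤ
alternating-zero {m} H {e} e∈H =
  trans (ΣS-toggle m e _) (Σ-vanish (allSubsets m) cancel)
  where
  cancel : ∀ I → [ ¬? (e ∈? I) ]· ([ I ⊆? H ]· σ I +ℤ [ I ∪ ⁅ e ⁆ ⊆? H ]· σ (I ∪ ⁅ e ⁆)) ≡ 0ℤ
  cancel I with e ∈? I | I ⊆? H | I ∪ ⁅ e ⁆ ⊆? H
  ... | yes _   | _       | _       = refl
  ... | no e∉I  | yes _   | yes _   = trans (cong (σ I +ℤ_) (σ-flip I e∉I)) (ℤ.+-inverseʳ (σ I))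
  ... | no _    | no _    | no _    = refl
  ... | no _    | yes I⊆H | no I∪e⊈H = ⊥-elim (I∪e⊈H (∪⁅⁆⊆ I⊆H e∈H))
  ... | no _    | no I⊈H  | yes I∪e⊆H = ⊥-elim (I⊈H (∪⁅⁆⊆⁻ I∪e⊆H))

every : (k : ℕ) → (Fin k → Bool) → Bool
every zero    p = true
every (suc k) p = p zero ∧ every k (p ∘ suc)

allB≡every : ∀ {m} (p : Fin m → Bool) → allB p ≡ every m p
allB≡every p = over-tabulate (λ i → i)
  where
  over-tabulate : ∀ {k} (f : Fin k → Fin _) → Vec.foldr _ (λ i b → p i ∧ b) true (tabulate f) ≡ every k (p ∘ f)
  over-tabulate {zero}  f = refl
  over-tabulate {suc k} f = cong (p (f zero) ∧_) (over-tabulate (f ∘ suc))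

every-T : ∀ k (p : Fin k → Bool) → T (every k p) ⇔ (∀ i → T (p i))
every-T k p = mk⇔ (to k p) (from k p)
  where
  to : ∀ k (p : Fin k → Bool) → T (every k p) → ∀ i → T (p i)
  to (suc k) p all zero    = proj₁ (Equivalence.to T-∧ all)
  to (suc k) p all (suc i) = to k (p ∘ suc) (proj₂ (Equivalence.to T-∧ all)) i
  from : ∀ k (p : Fin k → Bool) → (∀ i → T (p i)) → T (every k p)
  from zero    p all = _
  from (suc k) p all = Equivalence.from T-∧ (all zero , from k (p ∘ suc) (all ∘ suc))

every-true : ∀ k (p : Fin k → Bool) → (∀ i → p i ≡ true) → every k p ≡ true
every-true zero    p all = refl
every-true (suc k) p all = cong₂ _∧_ (all zero) (every-true k (p ∘ suc) (all ∘ suc))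

every-cong : ∀ k {p q : Fin k → Bool} → (∀ i → p i ≡ q i) → every k p ≡ every k q
every-cong zero    p≗q = refl
every-cong (suc k) p≗q = cong₂ _∧_ (p≗q zero) (every-cong k (p≗q ∘ suc))

every-∧ : ∀ k (p q : Fin k → Bool) → every k (λ i → p i ∧ q i) ≡ every k p ∧ every k q
every-∧ zero    p q = refl
every-∧ (suc k) p q =
  trans (cong ((p zero ∧ q zero) ∧_) (every-∧ k (p ∘ suc) (q ∘ suc))) (interchange (p zero) (q zero) _ _)
  where
  interchange : ∀ a b c d → (a ∧ b) ∧ (c ∧ d) ≡ (a ∧ c) ∧ (b ∧ d)
  interchange = solve 4 (λ a b c d → (a :* b) :* (c :* d) := (a :* c) :* (b :* d)) refl

every-snoc : ∀ k (p : Fin (suc k) → Bool) → every (suc k) p ≡ every k (p ∘ inject₁) ∧ p (fromℕ k)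
every-snoc zero    p = ∧-comm (p zero) true
every-snoc (suc k) p = trans (cong (p zero ∧_) (every-snoc k (p ∘ suc))) (sym (∧-assoc (p zero) _ _))

does-sound : ∀ {P : Set} (p? : Dec P) → T (does p?) → P
does-sound (yes p) _ = p

does-complete : ∀ {P : Set} (p? : Dec P) → P → T (does p?)
does-complete (yes _) _ = _
does-complete (no ¬p) p = ¬p p

does-refute : ∀ {P : Set} (p? : Dec P) → ¬ P → T (not (does p?))
does-refute (yes p) ¬p = ¬p p
does-refute (no _)  _  = _

does-refuted : ∀ {P : Set} (p? : Dec P) → T (not (does p?)) → ¬ P
does-refuted (no ¬p) _ = ¬p

≡ᵇ-refl : ∀ n → (n ≡ᵇ n) ≡ true
≡ᵇ-refl n = dec-true (n ≟ n) refl

≡ᵇ-false : ∀ {m n} → ¬ m ≡ n → (m ≡ᵇ n) ≡ false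
≡ᵇ-false {m} {n} = dec-false (m ≟ n)

_&_ : ∀ {a b} → T a → T b → T (a ∧ b)
ta & tb = Equivalence.from T-∧ (ta , tb)
infixr 4 _&_

unpair : ∀ a {b} → T (a ∧ b) → T a × T b
unpair _ = Equivalence.to T-∧

-- Elementary rank calculus

module _ {m} (M : Matroid m) where

  IsFlat : Subset m → Set
  IsFlat F = ∀ e → e ∈ F ⊎ rk M F < rk M (F ∪ ⁅ e ⁆)

  isFlat⇔IsFlat : (F : Subset m) → T (isFlat M F) ⇔ IsFlat F
  isFlat⇔IsFlat F = mk⇔
    (λ flat e → ⊎-map (Equivalence.from ∈⇔lookup) (<ᵇ⇒< _ _)
                       (Equivalence.to T-∨ (Equivalence.to pointwise flat e)))
    (λ flat → Equivalence.from pointwise (λ e →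
                Equivalence.from T-∨ (⊎-map (Equivalence.to ∈⇔lookup) <⇒<ᵇ (flat e))))
    where
    ∈⇔lookup : ∀ {e} → e ∈ F ⇔ T (lookup F e)
    ∈⇔lookup {e} = mk⇔ (λ e∈F → subst T (sym ([]=⇒lookup e∈F)) _)
                       (λ t → lookup⇒[]= e F (Equivalence.to T-≡ t))
    closed-at : Fin m → Bool
    closed-at e = lookup F e ∨ (rk M F <ᵇ rk M (F ∪ ⁅ e ⁆))
    pointwise : T (isFlat M F) ⇔ (∀ e → T (closed-at e))
    pointwise = subst (λ b → T b ⇔ (∀ e → T (closed-at e))) (sym (allB≡every closed-at)) (every-T m closed-at)

  flat? : (F : Subset m) → Dec (IsFlat F)
  flat? F = Dec-map (isFlat⇔IsFlat F) (T? (isFlat M F))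

  flat-grows : ∀ {F e} → IsFlat F → e ∉ F → rk M F < rk M (F ∪ ⁅ e ⁆)
  flat-grows {e = e} flat e∉F with flat e
  ... | inj₁ e∈F = contradiction e∈F e∉F
  ... | inj₂ grows = grows

  rk-⊥ : rk M ⊥ ≡ 0
  rk-⊥ = n≤0⇒n≡0 (subst (rk M ⊥ ≤_) (∣⊥∣≡0 m) (rk-bound M ⊥))

  element-of : ∀ {H j} → rk M H ≡ suc j → ∃ λ e → e ∈ H
  element-of {H} rkH with nonempty? H
  ... | yes e∈H = e∈H
  ... | no  H-empty = contradiction (trans (sym rk-⊥) (trans (cong (rk M) (sym (Empty-unique H-empty))) rkH)) 0≢1+n

  rk-insert : ∀ X e → rk M (X ∪ ⁅ e ⁆) ≤ suc (rk M X)
  rk-insert X e = begin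
    rk M (X ∪ ⁅ e ⁆)                          ≤⟨ m≤m+n _ _ ⟩
    rk M (X ∪ ⁅ e ⁆) + rk M (X ∩ ⁅ e ⁆)       ≤⟨ rk-submod M X ⁅ e ⁆ ⟩
    rk M X + rk M ⁅ e ⁆                       ≤⟨ +-monoʳ-≤ (rk M X) rk-singleton ⟩
    rk M X + 1                                ≡⟨ +-comm (rk M X) 1 ⟩
    suc (rk M X)                              ∎
    where
    open ≤-Reasoning
    rk-singleton : rk M ⁅ e ⁆ ≤ 1
    rk-singleton = subst (rk M ⁅ e ⁆ ≤_) (∣⁅x⁆∣≡1 e) (rk-bound M ⁅ e ⁆)

  rk-diminishing : ∀ {I Y} e → I ⊆ Y → rk M (Y ∪ ⁅ e ⁆) + rk M I ≤ rk M Y + rk M (I ∪ ⁅ e ⁆)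
  rk-diminishing {I} {Y} e I⊆Y = begin
    rk M (Y ∪ ⁅ e ⁆) + rk M I                            ≤⟨ +-mono-≤ (rk-mono M _ _ Y∪e⊆) (rk-mono M _ _ I⊆) ⟩
    rk M (Y ∪ (I ∪ ⁅ e ⁆)) + rk M (Y ∩ (I ∪ ⁅ e ⁆))      ≤⟨ rk-submod M Y (I ∪ ⁅ e ⁆) ⟩
    rk M Y + rk M (I ∪ ⁅ e ⁆)                            ∎
    where
    open ≤-Reasoning
    Y∪e⊆ : Y ∪ ⁅ e ⁆ ⊆ Y ∪ (I ∪ ⁅ e ⁆)
    Y∪e⊆ x∈ with x∈p∪q⁻ Y ⁅ e ⁆ x∈
    ... | inj₁ x∈Y = x∈p∪q⁺ (inj₁ x∈Y)
    ... | inj₂ x∈e = x∈p∪q⁺ (inj₂ (x∈p∪q⁺ (inj₂ x∈e)))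
    I⊆ : I ⊆ Y ∩ (I ∪ ⁅ e ⁆)
    I⊆ x∈I = x∈p∩q⁺ (I⊆Y x∈I , x∈p∪q⁺ (inj₁ x∈I))

  flat-absorbs : ∀ {G H I} → IsFlat G → I ⊆ G → I ⊆ H → rk M H ≤ rk M I → H ⊆ G
  flat-absorbs {G} {H} {I} G-flat I⊆G I⊆H rkH≤ {e} e∈H with e ∈? G
  ... | yes e∈G = e∈G
  ... | no  e∉G = contradiction (+-cancelʳ-≤ (rk M I) _ _ no-gain) (<⇒≱ (flat-grows G-flat e∉G))
    where
    no-gain : rk M (G ∪ ⁅ e ⁆) + rk M I ≤ rk M G + rk M I
    no-gain = ≤-trans (rk-diminishing e I⊆G)
                (+-monoʳ-≤ (rk M G) (≤-trans (rk-mono M _ _ (∪⁅⁆⊆ I⊆H e∈H)) rkH≤))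

  flat-unique : ∀ {G H I} → IsFlat G → IsFlat H → I ⊆ G → I ⊆ H →
    rk M G ≤ rk M I → rk M H ≤ rk M I → G ≡ H
  flat-unique G-flat H-flat I⊆G I⊆H rkG≤ rkH≤ =
    ⊆-antisym (flat-absorbs H-flat I⊆H I⊆G rkG≤) (flat-absorbs G-flat I⊆G I⊆H rkH≤)

  Closure : Subset m → Set
  Closure X = Σ (Subset m) λ H → X ⊆ H × IsFlat H × rk M H ≤ rk M X

  closure : ∀ X → Closure X
  closure X = grow m X (m≤n+m m ∣ X ∣)
    where
    -- add non-closing elements one at a time; d bounds the number still missing
    grow : ∀ d X → m ≤ ∣ X ∣ + d → Closure X
    grow d X room with flat? X
    ... | yes X-flat = X , ⊆-refl , X-flat , ≤-refl
    ... | no ¬flat with ¬∀⟶∃¬ m _ (λ e → e ∈? X ⊎-dec rk M X <? rk M (X ∪ ⁅ e ⁆)) ¬flat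
    ... | e , bad = step d room
      where
      e∉X : e ∉ X
      e∉X = bad ∘ inj₁
      no-gain : rk M (X ∪ ⁅ e ⁆) ≤ rk M X
      no-gain = ≮⇒≥ (bad ∘ inj₂)
      step : ∀ d → m ≤ ∣ X ∣ + d → Closure X
      step zero    room = contradiction (subst (_≤ m) (∣∪⁅⁆∣ X e∉X) (∣p∣≤n (X ∪ ⁅ e ⁆)))
                                        (≤⇒≯ (subst (m ≤_) (+-identityʳ _) room))
      step (suc d) room
        with grow d (X ∪ ⁅ e ⁆) (subst (m ≤_) (trans (+-suc ∣ X ∣ d) (cong (_+ d) (sym (∣∪⁅⁆∣ X e∉X)))) room)
      ... | H , X∪e⊆H , H-flat , rkH≤ = H , ∪⁅⁆⊆⁻ X∪e⊆H , H-flat , ≤-trans rkH≤ no-gain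

  rank-zero : Loopless M → ∀ I → rk M I ≤ 0 → I ≡ ⊥
  rank-zero loopless I rkI≤0 = Empty-unique λ { (e , e∈I) → contradiction (rk-of e e∈I) λ () }
    where
    rk-of : ∀ e → e ∈ I → 1 ≤ 0
    rk-of e e∈I = subst (_≤ 0) (loopless e) (≤-trans (rk-mono M _ _ e⊆I) rkI≤0)
      where
      e⊆I : ⁅ e ⁆ ⊆ I
      e⊆I x∈e = subst (_∈ I) (sym (x∈⁅y⁆⇒x≡y e x∈e)) e∈I

-- Rank-truncated alternating sums  A(G, j) = Σ_{I ⊆ G, rk I ≤ j} (-1)^|I|

module _ {m} (M : Matroid m) where

  A : Subset m → ℕ → ℤ
  A G j = ΣS m (λ I → [ I ⊆? G ×-dec rk M I ≤? j ]· σ I)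

  -- only the empty set survives the truncation at rank 0
  A-zero : Loopless M → ∀ G → A G 0 ≡ 1ℤ
  A-zero loopless G =
    trans (ΣS-unique m (λ I → I ⊆? G ×-dec rk M I ≤? 0) ⊥ σ (⊆-min G , ≤-reflexive (rk-⊥ M))
                       (λ I (_ , rkI≤0) → rank-zero M loopless I rkI≤0))
          (cong sign (∣⊥∣≡0 m))

  A-untruncated : ∀ H j → rk M H ≤ j → A H j ≡ ΣS m (λ I → [ I ⊆? H ]· σ I)
  A-untruncated H j rkH≤j = Σ-cong (allSubsets m) (λ I → drop-rank (I ⊆? H) (rk M I ≤? j))
    where
    drop-rank : ∀ {I} (I⊆?H : Dec (I ⊆ H)) (small? : Dec (rk M I ≤ j)) →
                [ I⊆?H ×-dec small? ]· σ I ≡ [ I⊆?H ]· σ I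
    drop-rank (yes I⊆H) (no  rkI≰j) = contradiction (≤-trans (rk-mono M _ _ I⊆H) rkH≤j) rkI≰j
    drop-rank (yes _)   (yes _)     = refl
    drop-rank (no  _)   _           = refl

  A-layer : ∀ H j → ΣS m (λ I → [ I ⊆? H ×-dec rk M I ≟ suc j ]· σ I) +ℤ A H j ≡ A H (suc j)
  A-layer H j = trans (sym (Σ-+ (allSubsets m) _ _))
    (Σ-cong (allSubsets m) (λ I → split-rank (I ⊆? H) (rk M I ≟ suc j) (rk M I ≤? j) (rk M I ≤? suc j)))
    where
    split-rank : ∀ {I} (I⊆?H : Dec (I ⊆ H)) (top? : Dec (rk M I ≡ suc j))
                 (≤j? : Dec (rk M I ≤ j)) (≤sj? : Dec (rk M I ≤ suc j)) →
                 [ I⊆?H ×-dec top? ]· σ I +ℤ [ I⊆?H ×-dec ≤j? ]· σ I ≡ [ I⊆?H ×-dec ≤sj? ]· σ I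
    split-rank (no  _) _          _          _          = refl
    split-rank (yes _) (yes ≡sj)  (yes ≤j)   _          = contradiction (subst (_≤ j) ≡sj ≤j) (n≮n j)
    split-rank (yes _) (yes _)    (no  _)    (yes _)    = ℤ.+-identityʳ _
    split-rank (yes _) (yes ≡sj)  (no  _)    (no  ≰sj)  = contradiction (≤-reflexive ≡sj) ≰sj
    split-rank (yes _) (no  _)    (yes ≤j)   (yes _)    = ℤ.+-identityˡ _
    split-rank (yes _) (no  _)    (yes ≤j)   (no  ≰sj)  = contradiction (m≤n⇒m≤1+n ≤j) ≰sj
    split-rank (yes _) (no  ≢sj)  (no  ≰j)   (yes ≤sj)  = contradiction (≤∧≮⇒≡ ≤sj (≰j ∘ s≤s⁻¹)) ≢sj
    split-rank (yes _) (no  _)    (no  _)    (no  _)    = refl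

Avoiding : ∀ {m} → Matroid m → Subset m → Fin m → ℕ → Subset m → Set
Avoiding M G s j H = IsFlat M H × rk M H ≡ suc j × H ⊆ G × s ∉ H

avoiding? : ∀ {m} (M : Matroid m) G s j H → Dec (Avoiding M G s j H)
avoiding? M G s j H = flat? M H ×-dec rk M H ≟ suc j ×-dec H ⊆? G ×-dec ¬? (s ∈? H)

module Deletion {m} (M : Matroid m) {G : Subset m} (G-flat : IsFlat M G) {s : Fin m} (s∈G : s ∈ G) (j : ℕ) where

  -- the subsets surviving the cancellation
  Critical : Subset m → Set
  Critical I = s ∉ I × I ⊆ G × rk M I ≤ suc j × ¬ rk M (I ∪ ⁅ s ⁆) ≤ suc j

  critical? : ∀ I → Dec (Critical I)
  critical? I = ¬? (s ∈? I) ×-dec I ⊆? G ×-dec rk M I ≤? suc j ×-dec ¬? (rk M (I ∪ ⁅ s ⁆) ≤? suc j)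

  -- pairing I with I ∪ {s} cancels every non-critical term of A(G, j+1)
  A-critical : A M G (suc j) ≡ ΣS m (λ I → [ critical? I ]· σ I)
  A-critical = trans (ΣS-toggle m s _) (Σ-cong (allSubsets m) (λ I →
    pair (s ∈? I) (I ⊆? G) (I ∪ ⁅ s ⁆ ⊆? G) (rk M I ≤? suc j) (rk M (I ∪ ⁅ s ⁆) ≤? suc j)))
    where
    pair : ∀ {I} (s∈?I : Dec (s ∈ I)) (I⊆?G : Dec (I ⊆ G)) (I∪s⊆?G : Dec (I ∪ ⁅ s ⁆ ⊆ G))
             (small? : Dec (rk M I ≤ suc j)) (small′? : Dec (rk M (I ∪ ⁅ s ⁆) ≤ suc j)) →
           [ ¬? s∈?I ]· ([ I⊆?G ×-dec small? ]· σ I +ℤ [ I∪s⊆?G ×-dec small′? ]· σ (I ∪ ⁅ s ⁆))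
           ≡ [ ¬? s∈?I ×-dec I⊆?G ×-dec small? ×-dec ¬? small′? ]· σ I
    pair (yes _)  _          _            _          _           = refl
    pair (no _)   (yes I⊆G)  (no I∪s⊈G)   _          _           = ⊥-elim (I∪s⊈G (∪⁅⁆⊆ I⊆G s∈G))
    pair (no _)   (no I⊈G)   (yes I∪s⊆G)  _          _           = ⊥-elim (I⊈G (∪⁅⁆⊆⁻ I∪s⊆G))
    pair (no _)   (no _)     (no _)       _          _           = refl
    pair {I} (no s∉I) (yes _) (yes _)     (yes _)    (yes _)     =
      trans (cong (σ I +ℤ_) (σ-flip I s∉I)) (ℤ.+-inverseʳ (σ I))
    pair (no _)   (yes _)    (yes _)      (yes _)    (no _)      = ℤ.+-identityʳ _
    pair (no _)   (yes _)    (yes _)      (no big)   (yes small′) =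
      contradiction (≤-trans (rk-mono M _ _ (p⊆p∪q ⁅ s ⁆)) small′) big
    pair (no _)   (yes _)    (yes _)      (no _)     (no _)      = refl

  critical-rank : ∀ {I} → Critical I → rk M I ≡ suc j
  critical-rank {I} (_ , _ , small , big) = ≤-antisym small (s≤s⁻¹ (≤-trans (≰⇒> big) (rk-insert M I s)))

  avoiding⇒critical : ∀ {H I} → Avoiding M G s j H → I ⊆ H → rk M I ≡ suc j → Critical I
  avoiding⇒critical {H} {I} (H-flat , rkH , H⊆G , s∉H) I⊆H rkI =
    (λ s∈I → s∉H (I⊆H s∈I)) , (λ x∈I → H⊆G (I⊆H x∈I)) , ≤-reflexive rkI , <⇒≱ jump
    where
    gain : rk M H + suc (rk M I) ≤ rk M H + rk M (I ∪ ⁅ s ⁆)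
    gain = subst (_≤ rk M H + rk M (I ∪ ⁅ s ⁆)) (sym (+-suc (rk M H) (rk M I)))
             (≤-trans (+-monoˡ-≤ (rk M I) (flat-grows M H-flat s∉H)) (rk-diminishing M s I⊆H))
    jump : suc j < rk M (I ∪ ⁅ s ⁆)
    jump = subst (_< rk M (I ∪ ⁅ s ⁆)) rkI (+-cancelˡ-≤ (rk M H) _ _ gain)

  -- a critical set lies in exactly one avoiding flat: its closure
  critical-closure : ∀ {I} → Critical I →
    Σ (Subset m) λ H₀ → Avoiding M G s j H₀ × I ⊆ H₀ × (∀ H → Avoiding M G s j H → I ⊆ H → H ≡ H₀)
  critical-closure {I} c@(_ , I⊆G , _ , big) with closure M I
  ... | H₀ , I⊆H₀ , H₀-flat , rkH₀≤ = H₀ , (H₀-flat , rkH₀ , H₀⊆G , s∉H₀) , I⊆H₀ , unique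
    where
    rkI : rk M I ≡ suc j
    rkI = critical-rank c
    rkH₀ : rk M H₀ ≡ suc j
    rkH₀ = trans (≤-antisym rkH₀≤ (rk-mono M _ _ I⊆H₀)) rkI
    H₀⊆G : H₀ ⊆ G
    H₀⊆G = flat-absorbs M G-flat I⊆G I⊆H₀ rkH₀≤
    s∉H₀ : s ∉ H₀
    s∉H₀ s∈H₀ = big (subst (rk M (I ∪ ⁅ s ⁆) ≤_) rkH₀ (rk-mono M _ _ (∪⁅⁆⊆ I⊆H₀ s∈H₀)))
    unique : ∀ H → Avoiding M G s j H → I ⊆ H → H ≡ H₀
    unique H (H-flat , rkH , _) I⊆H =
      flat-unique M H-flat H₀-flat I⊆H I⊆H₀ (≤-reflexive (trans rkH (sym rkI))) rkH₀≤

  critical-as-sum : ∀ I → [ critical? I ]· σ I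
                        ≡ ΣS m (λ H → [ avoiding? M G s j H ×-dec I ⊆? H ×-dec rk M I ≟ suc j ]· σ I)
  critical-as-sum I = by-cases (critical? I)
    where
    by-cases : (c? : Dec (Critical I)) →
      [ c? ]· σ I ≡ ΣS m (λ H → [ avoiding? M G s j H ×-dec I ⊆? H ×-dec rk M I ≟ suc j ]· σ I)
    by-cases (yes c) with critical-closure c
    ... | H₀ , H₀-avoiding , I⊆H₀ , unique =
      sym (ΣS-unique m (λ H → avoiding? M G s j H ×-dec I ⊆? H ×-dec rk M I ≟ suc j) H₀ (λ _ → σ I)
             (H₀-avoiding , I⊆H₀ , critical-rank c) (λ H (a , I⊆H , _) → unique H a I⊆H))
    by-cases (no ¬c) = sym (Σ-vanish (allSubsets m) (λ H → none (avoiding? M G s j H) (I ⊆? H) (rk M I ≟ suc j)))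
      where
      none : ∀ {H} (a? : Dec (Avoiding M G s j H)) (I⊆?H : Dec (I ⊆ H)) (rk? : Dec (rk M I ≡ suc j)) →
             [ a? ×-dec I⊆?H ×-dec rk? ]· σ I ≡ 0ℤ
      none (yes a) (yes I⊆H) (yes rkI) = contradiction (avoiding⇒critical a I⊆H rkI) ¬c
      none (yes _) (yes _)   (no _)    = refl
      none (yes _) (no _)    _         = refl
      none (no _)  _         _         = refl

  top-layer : ∀ {H} → Avoiding M G s j H → ΣS m (λ I → [ I ⊆? H ×-dec rk M I ≟ suc j ]· σ I) ≡ - A M H j
  top-layer {H} (_ , rkH , _) = inverseˡ-unique _ _ (begin
    ΣS m (λ I → [ I ⊆? H ×-dec rk M I ≟ suc j ]· σ I) +ℤ A M H j  ≡⟨ A-layer M H j ⟩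
    A M H (suc j)                                              ≡⟨ A-untruncated M H (suc j) (≤-reflexive rkH) ⟩
    ΣS m (λ I → [ I ⊆? H ]· σ I)                               ≡⟨ alternating-zero H (proj₂ (element-of M rkH)) ⟩
    0ℤ                                                         ∎)
    where open ≡-Reasoning

  deletion : A M G (suc j) ≡ - ΣS m (λ H → [ avoiding? M G s j H ]· A M H j)
  deletion = begin
    A M G (suc j)                                                          ≡⟨ A-critical ⟩
    ΣS m (λ I → [ critical? I ]· σ I)                                      ≡⟨ Σ-cong (allSubsets m) critical-as-sum ⟩
    ΣS m (λ I → ΣS m (λ H → [ avoiding? M G s j H ×-dec I ⊆? H ×-dec rk M I ≟ suc j ]· σ I))
                                                                           ≡⟨ Σ-swap (allSubsets m) (allSubsets m) _ ⟩
    ΣS m (λ H → ΣS m (λ I → [ avoiding? M G s j H ×-dec I ⊆? H ×-dec rk M I ≟ suc j ]· σ I))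
                                                                           ≡⟨ Σ-cong (allSubsets m) (λ H → per-flat (avoiding? M G s j H)) ⟩
    ΣS m (λ H → - [ avoiding? M G s j H ]· A M H j)                        ≡⟨ Σ-neg (allSubsets m) _ ⟩
    - ΣS m (λ H → [ avoiding? M G s j H ]· A M H j)                        ∎
    where
    open ≡-Reasoning
    per-flat : ∀ {H} (a? : Dec (Avoiding M G s j H)) →
      ΣS m (λ I → [ a? ×-dec I ⊆? H ×-dec rk M I ≟ suc j ]· σ I) ≡ - [ a? ]· A M H j
    per-flat (yes a) = top-layer a
    per-flat (no _)  = Σ-vanish (allSubsets m) (λ _ → refl)

minElem-≤ : ∀ {m} {X : Subset m} {e} → e ∈ X → minElem X ≤ toℕ e
minElem-≤ {X = inside  ∷ _} _         = z≤n
minElem-≤ {X = outside ∷ _} (there p) = s≤s (minElem-≤ p)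

minElem-attained : ∀ {m} {X : Subset m} {e} → e ∈ X → ∃ λ t → t ∈ X × toℕ t ≡ minElem X
minElem-attained {X = inside  ∷ _} _ = zero , here , refl
minElem-attained {X = outside ∷ _} (there p) with minElem-attained p
... | t , t∈X , t-min = suc t , there t∈X , cong suc t-min

-- Counting descending flags from the top, and their alternating-sum formula

module _ {m} (M : Matroid m) where

  -- F can sit at position i (rank i+1) of an initial flag avoiding 0
  member : Subset m → ℕ → Bool
  member F i = isFlat M F ∧ isNonempty F ∧ isProper F ∧ (rk M F ≡ᵇ suc i) ∧ (0 <ᵇ minElem F)

  stepUp : Subset m → Subset m → Bool
  stepUp F G = does (F ⊆? G) ∧ not (does (G ⊆? F)) ∧ (minElem G <ᵇ minElem F)

  -- H can be the top member F_{j+1} of a flag continuing upwards to G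
  nextBelow : ℕ → Subset m → Subset m → Bool
  nextBelow j G H = member H j ∧ stepUp H G

  -- the number of j-step initial descending flags continuing upwards to G
  flagsBelow : ℕ → Subset m → ℤ
  flagsBelow zero    G = 1ℤ
  flagsBelow (suc j) G = ΣS m (λ H → [ T? (nextBelow j G H) ]· flagsBelow j H)

  nextBelow⇔avoiding : ∀ {G s} j → s ∈ G → toℕ s ≡ minElem G →
                       ∀ H → T (nextBelow j G H) ⇔ Avoiding M G s j H
  nextBelow⇔avoiding {G} {s} j s∈G s-min H = mk⇔ to from
    where
    to : T (nextBelow j G H) → Avoiding M G s j H
    to t =
      let (mem , step) = unpair (member H j) t
          (flat , mem₁) = unpair (isFlat M H) mem
          (_ , mem₂) = unpair (isNonempty H) mem₁
          (_ , mem₃) = unpair (isProper H) mem₂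
          (rank , _) = unpair (rk M H ≡ᵇ suc j) mem₃
          (H⊆G , step₁) = unpair (does (H ⊆? G)) step
          (_ , min<) = unpair (not (does (G ⊆? H))) step₁
      in Equivalence.to (isFlat⇔IsFlat M H) flat ,
         does-sound (rk M H ≟ suc j) rank ,
         does-sound (H ⊆? G) H⊆G ,
         λ s∈H → <⇒≱ (does-sound (minElem G <? minElem H) min<) (subst (minElem H ≤_) s-min (minElem-≤ s∈H))
    from : Avoiding M G s j H → T (nextBelow j G H)
    from (H-flat , rkH , H⊆G , s∉H) =
      (Equivalence.from (isFlat⇔IsFlat M H) H-flat
        & does-refute (H ⊆? ⊥ ×-dec ⊥ ⊆? H) (λ (H⊆⊥ , _) → ∉⊥ (H⊆⊥ e∈H))
        & does-refute (H ⊆? ⊤ ×-dec ⊤ ⊆? H) (λ (_ , ⊤⊆H) → s∉H (⊤⊆H ∈⊤))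
        & does-complete (rk M H ≟ suc j) rkH
        & does-complete (0 <? minElem H) (≤-trans (s≤s z≤n) min<))
      & (does-complete (H ⊆? G) H⊆G
        & does-refute (G ⊆? H) (λ G⊆H → s∉H (G⊆H s∈G))
        & does-complete (minElem G <? minElem H) min<)
      where
      e∈H : _ ∈ H
      e∈H = proj₂ (element-of M rkH)
      -- the minimum of H is an element of G other than s = min G
      min< : minElem G < minElem H
      min< with minElem-attained e∈H
      ... | t , t∈H , t-min =
        ≤∧≢⇒< (subst (minElem G ≤_) t-min (minElem-≤ (H⊆G t∈H)))
              (λ same → s∉H (subst (_∈ H) (toℕ-injective (trans t-min (trans (sym same) (sym s-min)))) t∈H))

  flagsBelow-alternating : Loopless M → ∀ j {G e} → IsFlat M G → e ∈ G → sign j *ℤ A M G j ≡ flagsBelow j G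
  flagsBelow-alternating loopless zero {G} _ _ = trans (ℤ.*-identityˡ _) (A-zero M loopless G)
  flagsBelow-alternating loopless (suc j) {G} G-flat e∈G with minElem-attained e∈G
  ... | s , s∈G , s-min = begin
    sign (suc j) *ℤ A M G (suc j)
      ≡⟨ cong (sign (suc j) *ℤ_) (Deletion.deletion M G-flat s∈G j) ⟩
    (- sign j) *ℤ (- ΣS m (λ H → [ avoid? H ]· A M H j))
      ≡⟨ neg-*-neg (sign j) _ ⟩
    sign j *ℤ ΣS m (λ H → [ avoid? H ]· A M H j)
      ≡⟨ sym (Σ-*ˡ (allSubsets m) (sign j) _) ⟩
    ΣS m (λ H → sign j *ℤ [ avoid? H ]· A M H j)
      ≡⟨ Σ-cong (allSubsets m) (λ H → per-flat (avoid? H) (T? (nextBelow j G H))) ⟩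
    flagsBelow (suc j) G
      ∎
    where
    open ≡-Reasoning
    avoid? : ∀ H → Dec (Avoiding M G s j H)
    avoid? = avoiding? M G s j
    neg-*-neg : ∀ a b → (- a) *ℤ (- b) ≡ a *ℤ b
    neg-*-neg = solve-∀
    per-flat : ∀ {H} (a? : Dec (Avoiding M G s j H)) (b? : Dec (T (nextBelow j G H))) →
               sign j *ℤ [ a? ]· A M H j ≡ [ b? ]· flagsBelow j H
    per-flat (yes (H-flat , rkH , _)) (yes _) = flagsBelow-alternating loopless j H-flat (proj₂ (element-of M rkH))
    per-flat (no _)  (no _)  = ℤ.*-zeroʳ (sign j)
    per-flat (yes a) (no ¬b) = contradiction (Equivalence.from (nextBelow⇔avoiding j s∈G s-min _) a) ¬b
    per-flat (no ¬a) (yes b) = contradiction (Equivalence.to (nextBelow⇔avoiding j s∈G s-min _) b) ¬a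

lookup-∷ʳ-inject₁ : ∀ {A : Set} {k} (w : Vec A k) x i → lookup (w ∷ʳ x) (inject₁ i) ≡ lookup w i
lookup-∷ʳ-inject₁ (y ∷ w) x zero    = refl
lookup-∷ʳ-inject₁ (y ∷ w) x (suc i) = lookup-∷ʳ-inject₁ w x i

lookup-∷ʳ-last : ∀ {A : Set} {k} (w : Vec A k) x → lookup (w ∷ʳ x) (fromℕ k) ≡ x
lookup-∷ʳ-last []      x = refl
lookup-∷ʳ-last (y ∷ w) x = lookup-∷ʳ-last w x

Σ-allVecs-suc : ∀ {A : Set} (xs : List A) k (f : Vec A (suc k) → ℤ) →
  ΣL (allVecs xs (suc k)) f ≡ ΣL xs (λ x → ΣL (allVecs xs k) (λ v → f (x ∷ v)))
Σ-allVecs-suc xs k f =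
  trans (Σ-concatMap _ xs f) (Σ-cong xs (λ x → Σ-map (x ∷_) (allVecs xs k) f))

Σ-allVecs-snoc : ∀ {A : Set} (xs : List A) k (f : Vec A (suc k) → ℤ) →
  ΣL (allVecs xs (suc k)) f ≡ ΣL (allVecs xs k) (λ w → ΣL xs (λ x → f (w ∷ʳ x)))
Σ-allVecs-snoc xs zero f =
  trans (Σ-allVecs-suc xs zero f) (trans (Σ-cong xs (λ x → ℤ.+-identityʳ _)) (sym (ℤ.+-identityʳ _)))
Σ-allVecs-snoc xs (suc k) f =
  trans (Σ-allVecs-suc xs (suc k) f)
        (trans (Σ-cong xs (λ x → Σ-allVecs-snoc xs k (f ∘ (x ∷_)))) (sym (Σ-allVecs-suc xs k _)))

length-filter : {A : Set} (p : A → Bool) (xs : List A) →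
  + length (filter (λ x → p x Data.Bool.≟ true) xs) ≡ ΣL xs (λ x → [ T? (p x) ]· 1ℤ)
length-filter p []       = refl
length-filter p (x ∷ xs) with p x
... | true  = cong (1ℤ +ℤ_) (length-filter p xs)
... | false = trans (length-filter p xs) (sym (ℤ.+-identityˡ _))

module _ {m} (M : Matroid m) where

  members : ∀ k → Vec (Subset m) k → Bool
  members k w = every k (λ i → member M (lookup w i) (toℕ i))

  link : ∀ {k} → Vec (Subset m) k → Fin k → Fin k → Bool
  link w i j = not (suc (toℕ i) ≡ᵇ toℕ j) ∨ stepUp M (lookup w i) (lookup w j)

  steps : ∀ k → Vec (Subset m) k → Bool
  steps k w = every k (λ i → every k (link w i))

  isInitialDescFlag≡ : ∀ k (w : Vec (Subset m) k) → isInitialDescFlag M w ≡ members k w ∧ steps k w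
  isInitialDescFlag≡ k w = cong₂ _∧_ (allB≡every (λ i → member M (lookup w i) (toℕ i)))
    (trans (allB≡every (λ i → allB (link w i))) (every-cong k (λ i → allB≡every (link w i))))

  topStep : ∀ k → Vec (Subset m) k → Subset m → Bool
  topStep zero    w G = true
  topStep (suc k) w G = stepUp M (lookup w (fromℕ k)) G

  isFlagBelow : ∀ k → Subset m → Vec (Subset m) k → Bool
  isFlagBelow k G w = isInitialDescFlag M w ∧ topStep k w G

  members-snoc : ∀ k w x → members (suc k) (w ∷ʳ x) ≡ members k w ∧ member M x k
  members-snoc k w x = trans (every-snoc k (λ i → member M (lookup (w ∷ʳ x) i) (toℕ i))) (cong₂ _∧_
    (every-cong k (λ i → cong₂ (member M) (lookup-∷ʳ-inject₁ w x i) (toℕ-inject₁ i)))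
    (cong₂ (member M) (lookup-∷ʳ-last w x) (toℕ-fromℕ k)))

  -- appending x adds exactly one link, from the old top to x
  steps-snoc : ∀ k w x → steps (suc k) (w ∷ʳ x) ≡ steps k w ∧ topStep k w x
  steps-snoc k w x = begin
    every (suc k) (λ i → every (suc k) (link v i))
      ≡⟨ every-snoc k (λ i → every (suc k) (link v i)) ⟩
    every k (λ i → every (suc k) (link v (inject₁ i))) ∧ every (suc k) (link v (fromℕ k))
      ≡⟨ cong₂ _∧_ (every-cong k (λ i → every-snoc k (link v (inject₁ i)))) (every-true (suc k) (link v (fromℕ k)) from-top) ⟩
    every k (λ i → every k (λ j → link v (inject₁ i) (inject₁ j)) ∧ link v (inject₁ i) (fromℕ k)) ∧ true
      ≡⟨ ∧-identityʳ _ ⟩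
    every k (λ i → every k (λ j → link v (inject₁ i) (inject₁ j)) ∧ link v (inject₁ i) (fromℕ k))
      ≡⟨ every-∧ k (λ i → every k (λ j → link v (inject₁ i) (inject₁ j))) (λ i → link v (inject₁ i) (fromℕ k)) ⟩
    every k (λ i → every k (λ j → link v (inject₁ i) (inject₁ j))) ∧ every k (λ i → link v (inject₁ i) (fromℕ k))
      ≡⟨ cong₂ _∧_ (every-cong k (λ i → every-cong k (old-link i))) (to-top k w x) ⟩
    steps k w ∧ topStep k w x
      ∎
    where
    open ≡-Reasoning
    v = w ∷ʳ x
    from-top : ∀ j → link v (fromℕ k) j ≡ true
    from-top j rewrite toℕ-fromℕ k | ≡ᵇ-false (<⇒≢ (toℕ<n j) ∘ sym) = refl
    old-link : ∀ i j → link v (inject₁ i) (inject₁ j) ≡ link w i j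
    old-link i j rewrite toℕ-inject₁ i | toℕ-inject₁ j | lookup-∷ʳ-inject₁ w x i | lookup-∷ʳ-inject₁ w x j = refl
    to-top : ∀ k (w : Vec (Subset m) k) x → every k (λ i → link (w ∷ʳ x) (inject₁ i) (fromℕ k)) ≡ topStep k w x
    to-top zero    w x = refl
    to-top (suc k) w x = trans (every-snoc k (λ i → link (w ∷ʳ x) (inject₁ i) (fromℕ (suc k))))
                                 (cong₂ _∧_ (every-true k (λ i → link (w ∷ʳ x) (inject₁ (inject₁ i)) (fromℕ (suc k))) far) near)
      where
      far : ∀ i → link (w ∷ʳ x) (inject₁ (inject₁ i)) (fromℕ (suc k)) ≡ true
      far i rewrite toℕ-inject₁ (inject₁ i) | toℕ-inject₁ i | toℕ-fromℕ k | ≡ᵇ-false (<⇒≢ (toℕ<n i)) = refl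
      near : link (w ∷ʳ x) (inject₁ (fromℕ k)) (fromℕ (suc k)) ≡ stepUp M (lookup w (fromℕ k)) x
      near rewrite toℕ-inject₁ (fromℕ k) | toℕ-fromℕ k | ≡ᵇ-refl k
                 | lookup-∷ʳ-inject₁ w x (fromℕ k) | lookup-∷ʳ-last w x = refl

  isFlagBelow-snoc : ∀ k G w x → isFlagBelow (suc k) G (w ∷ʳ x) ≡ nextBelow M k G x ∧ isFlagBelow k x w
  isFlagBelow-snoc k G w x = begin
    isInitialDescFlag M (w ∷ʳ x) ∧ topStep (suc k) (w ∷ʳ x) G
      ≡⟨ cong₂ _∧_ (trans (isInitialDescFlag≡ (suc k) (w ∷ʳ x)) (cong₂ _∧_ (members-snoc k w x) (steps-snoc k w x)))
                   (cong (λ F → stepUp M F G) (lookup-∷ʳ-last w x)) ⟩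
    ((members k w ∧ member M x k) ∧ (steps k w ∧ topStep k w x)) ∧ stepUp M x G
      ≡⟨ regroup (members k w) (member M x k) (steps k w) (topStep k w x) (stepUp M x G) ⟩
    (member M x k ∧ stepUp M x G) ∧ ((members k w ∧ steps k w) ∧ topStep k w x)
      ≡⟨ cong (λ b → nextBelow M k G x ∧ (b ∧ topStep k w x)) (sym (isInitialDescFlag≡ k w)) ⟩
    nextBelow M k G x ∧ isFlagBelow k x w
      ∎
    where
    open ≡-Reasoning
    regroup : ∀ a b c d e → ((a ∧ b) ∧ (c ∧ d)) ∧ e ≡ (b ∧ e) ∧ ((a ∧ c) ∧ d)
    regroup = solve 5 (λ a b c d e → ((a :* b) :* (c :* d)) :* e := (b :* e) :* ((a :* c) :* d)) refl

  flagsBelow-enumerated : ∀ k G →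
    ΣL (allVecs (allSubsets m) k) (λ w → [ T? (isFlagBelow k G w) ]· 1ℤ) ≡ flagsBelow M k G
  flagsBelow-enumerated zero    G = refl
  flagsBelow-enumerated (suc k) G = begin
    ΣL (allVecs (allSubsets m) (suc k)) (λ w → [ T? (isFlagBelow (suc k) G w) ]· 1ℤ)
      ≡⟨ Σ-allVecs-snoc (allSubsets m) k _ ⟩
    ΣL (allVecs (allSubsets m) k) (λ w → ΣS m (λ x → [ T? (isFlagBelow (suc k) G (w ∷ʳ x)) ]· 1ℤ))
      ≡⟨ Σ-cong (allVecs (allSubsets m) k) (λ w → Σ-cong (allSubsets m) (λ x →
           trans (cong (λ b → [ T? b ]· 1ℤ) (isFlagBelow-snoc k G w x)) (guard-∧ (nextBelow M k G x) (isFlagBelow k x w) 1ℤ))) ⟩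
    ΣL (allVecs (allSubsets m) k) (λ w → ΣS m (λ x → [ T? (nextBelow M k G x) ]· ([ T? (isFlagBelow k x w) ]· 1ℤ)))
      ≡⟨ Σ-swap (allVecs (allSubsets m) k) (allSubsets m) _ ⟩
    ΣS m (λ x → ΣL (allVecs (allSubsets m) k) (λ w → [ T? (nextBelow M k G x) ]· ([ T? (isFlagBelow k x w) ]· 1ℤ)))
      ≡⟨ Σ-cong (allSubsets m) (λ x → trans (Σ-guard (T? (nextBelow M k G x)) (allVecs (allSubsets m) k) _)
                                            (cong ([ T? (nextBelow M k G x) ]·_) (flagsBelow-enumerated k x))) ⟩
    flagsBelow M (suc k) G
      ∎
    where open ≡-Reasoning

-- on Fin (suc n) every flag lies below ⊤: its members are proper and miss 0 = min ⊤
module _ {n} (M : Matroid (suc n)) where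

  topStep-⊤ : ∀ k (w : Vec (Subset (suc n)) k) → T (isInitialDescFlag M w) → T (topStep M k w ⊤)
  topStep-⊤ zero    w _    = _
  topStep-⊤ (suc k) w flag =
    let (_ , mem₁)      = unpair (isFlat M F) mem
        (_ , mem₂)      = unpair (isNonempty F) mem₁
        (proper , mem₃) = unpair (isProper F) mem₂
        (_ , positive)  = unpair (rk M F ≡ᵇ _) mem₃
    in does-complete (F ⊆? ⊤) ⊆⊤
       & does-refute (⊤ ⊆? F) (λ ⊤⊆F → does-refuted (F ⊆? ⊤ ×-dec ⊤ ⊆? F) proper (⊆⊤ , ⊤⊆F))
       & positive
    where
    F : Subset (suc n)
    F = lookup w (fromℕ k)
    mem : T (member M F (toℕ (fromℕ k)))
    mem = Equivalence.to (every-T (suc k) (λ i → member M (lookup w i) (toℕ i)))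
            (proj₁ (unpair (members M (suc k) w) (subst T (isInitialDescFlag≡ M (suc k) w) flag))) (fromℕ k)

  cardD-as-count : ∀ k → + cardD M k ≡ ΣL (allVecs (allSubsets (suc n)) k) (λ w → [ T? (isFlagBelow M k ⊤ w) ]· 1ℤ)
  cardD-as-count k = trans (length-filter (isInitialDescFlag M) (allVecs (allSubsets (suc n)) k))
    (Σ-cong (allVecs (allSubsets (suc n)) k) (λ w → top-free (isInitialDescFlag M w) (topStep M k w ⊤) (topStep-⊤ k w)))
    where
    top-free : ∀ a b → (T a → T b) → [ T? a ]· 1ℤ ≡ [ T? (a ∧ b) ]· 1ℤ
    top-free false b     _    = refl
    top-free true  true  _    = refl
    top-free true  false a⇒b  = ⊥-elim (a⇒b _)

-- The reduced characteristic polynomial through A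

corank-threshold : ∀ {r k R x} → k ≤ r → R ≡ suc r → (r ∸ k < R ∸ x ⇔ x ≤ k)
corank-threshold {r} {k} {x = x} k≤r refl = mk⇔ to from
  where
  to : r ∸ k < suc r ∸ x → x ≤ k
  to lt with x ≤? k
  ... | yes x≤k = x≤k
  ... | no  x≰k = contradiction lt (≤⇒≯ (∸-monoʳ-≤ (suc r) (≰⇒> x≰k)))
  from : x ≤ k → r ∸ k < suc r ∸ x
  from x≤k = ≤-trans (≤-reflexive (sym (+-∸-assoc 1 k≤r))) (∸-monoʳ-≤ (suc r) x≤k)

module _ {m} (M : Matroid m) where

  chiBarCoeff-as-A : ∀ {r k} → rk M ⊤ ≡ suc r → k ≤ r → chiBarCoeff M (r ∸ k) ≡ A M ⊤ k
  chiBarCoeff-as-A {r} {k} rk⊤ k≤r = begin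
    chiBarCoeff M j
      ≡⟨⟩
    ΣL (upTo N) (λ i → [ j <? i ]· ΣS m (λ I → [ crk M I ≟ i ]· σ I))
      ≡⟨ Σ-cong (upTo N) (λ i → sym (Σ-guard (j <? i) (allSubsets m) _)) ⟩
    ΣL (upTo N) (λ i → ΣS m (λ I → [ j <? i ]· ([ crk M I ≟ i ]· σ I)))
      ≡⟨ Σ-swap (upTo N) (allSubsets m) _ ⟩
    ΣS m (λ I → ΣL (upTo N) (λ i → [ j <? i ]· ([ crk M I ≟ i ]· σ I)))
      ≡⟨ Σ-cong (allSubsets m) pick-corank ⟩
    ΣS m (λ I → [ j <? crk M I ]· σ I)
      ≡⟨ Σ-cong (allSubsets m) (λ I → guard-⇔ (threshold I) (j <? crk M I) (I ⊆? ⊤ ×-dec rk M I ≤? k) (σ I)) ⟩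
    A M ⊤ k
      ∎
    where
    open ≡-Reasoning
    j N : ℕ
    j = r ∸ k
    N = suc (rk M ⊤)
    pick-corank : ∀ I → ΣL (upTo N) (λ i → [ j <? i ]· ([ crk M I ≟ i ]· σ I)) ≡ [ j <? crk M I ]· σ I
    pick-corank I = trans (Σ-cong (upTo N) (λ i → guard-comm (j <? i) (crk M I ≟ i) (σ I)))
                          (Σ-upTo-delta (λ i → [ j <? i ]· σ I) N (crk M I) (s≤s (m∸n≤m (rk M ⊤) (rk M I))))
    threshold : ∀ I → j < crk M I ⇔ (I ⊆ ⊤ × rk M I ≤ k)
    threshold I = mk⇔ (λ j<crk → (λ {x} → ⊆⊤) , Equivalence.to (corank-threshold k≤r rk⊤) j<crk)
                      (λ (_ , rkI≤k) → Equivalence.from (corank-threshold k≤r rk⊤) rkI≤k)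

  mu-as-A : ∀ {r k} → rk M ⊤ ≡ suc r → k ≤ r → mu M k ≡ sign k *ℤ A M ⊤ k
  mu-as-A {r} {k} rk⊤ k≤r =
    trans (cong (λ R → sign k *ℤ chiBarCoeff M ((R ∸ 1) ∸ k)) rk⊤) (cong (sign k *ℤ_) (chiBarCoeff-as-A rk⊤ k≤r))

-- Lemma 9.3: μ^k(M) = |D_k(M)|

lemma9p3 : (n r : ℕ) (M : Matroid (suc n)) → Loopless M → rk M ⊤ ≡ suc r →
    (k : ℕ) → 1 ≤ k → k ≤ r → mu M k ≡ + cardD M k
lemma9p3 n r M loopless rk⊤ k _ k≤r = begin
  mu M k                                                                      ≡⟨ mu-as-A M rk⊤ k≤r ⟩
  sign k *ℤ A M ⊤ k                                                           ≡⟨ flagsBelow-alternating M loopless k ⊤-flat (∈⊤ {x = zero}) ⟩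
  flagsBelow M k ⊤                                                            ≡⟨ flagsBelow-enumerated M k ⊤ ⟨
  ΣL (allVecs (allSubsets (suc n)) k) (λ w → [ T? (isFlagBelow M k ⊤ w) ]· 1ℤ)  ≡⟨ cardD-as-count M k ⟨
  + cardD M k                                                                 ∎
  where
  open ≡-Reasoning
  ⊤-flat : IsFlat M ⊤
  ⊤-flat e = inj₁ ∈⊤
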